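{- Let $G$ be a graph that has exactly two odd cycles, and suppose these two cycles share no edge. Then the two cycles intersect either in a single vertex or not at all.
   Context: Graphs are finite and simple; an odd cycle of $G$ is a cycle subgraph of $G$ of odd length. -}

module Defs where

open import Data.Nat using (ℕ; suc; _+_; _*_; _≤_)
open import Data.Fin using (Fin)
open import Data.Bool using (Bool; true; false)
open import Data.List using (List; []; _∷_; _++_; length; [_])
open import Data.List.Relation.Unary.Linked using (Linked)
open import Data.List.Relation.Unary.Unique.Propositional using (Unique)
open import Data.List.Membership.Propositional using (_∈_)
open import Data.Product using (Σ; _×_; ∃)
open import Data.Sum using (_⊎_)
open import Relation.Binary.PropositionalEquality using (_≡_)
open import Relation.Nullary using (¬_)

-- A finite simple graph on vertex set Fin n: symmetric, irreflexive
-- Bool-valued adjacency (so each edge is present or not; no multi-edges).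
record Graph (n : ℕ) : Set where
  field
    adj   : Fin n → Fin n → Bool
    sym   : ∀ u v → adj u v ≡ adj v u
    irrefl : ∀ v → adj v v ≡ false
open Graph public

Adj : ∀ {n} → Graph n → Fin n → Fin n → Set
Adj G u v = adj G u v ≡ true

-- A cycle in G, given by a cyclic sequence of pairwise distinct vertices
-- first ∷ rest (length ≥ 3), each consecutive pair adjacent, including
-- the closing pair (last, first).
record Cycle {n : ℕ} (G : Graph n) : Set where
  field
    first  : Fin n
    rest   : List (Fin n)
    long   : 2 ≤ length rest
    distinct : Unique (first ∷ rest)
    closed : Linked (Adj G) (first ∷ rest ++ [ first ])
open Cycle public

len : ∀ {n} {G : Graph n} → Cycle G → ℕ
len C = suc (length (rest C))

Odd : ℕ → Set
Odd k = Σ ℕ λ m → k ≡ suc (2 * m)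

data Consec {A : Set} : List A → A → A → Set where
  here  : ∀ {x y xs} → Consec (x ∷ y ∷ xs) x y
  there : ∀ {x xs u v} → Consec xs u v → Consec (x ∷ xs) u v

VertexOf : ∀ {n} {G : Graph n} → Cycle G → Fin n → Set
VertexOf C v = v ∈ (first C ∷ rest C)

EdgeOf : ∀ {n} {G : Graph n} → Cycle G → Fin n → Fin n → Set
EdgeOf C u v = Consec (first C ∷ rest C ++ [ first C ]) u v
             ⊎ Consec (first C ∷ rest C ++ [ first C ]) v u

SameCycle : ∀ {n} {G : Graph n} → Cycle G → Cycle G → Set
SameCycle C D = (∀ v → (VertexOf C v → VertexOf D v) × (VertexOf D v → VertexOf C v))
              × (∀ u v → (EdgeOf C u v → EdgeOf D u v) × (EdgeOf D u v → EdgeOf C u v))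

module Submission where

-- Suppose C and D share two distinct vertices.  Walking around D we find an
-- "ear": a path x ys y of D whose end points lie on C and whose interior ys
-- avoids C.  The end points cut C into two arcs x F y and y B x, and since
-- |F| + |B| + 2 = len C is odd, one of the cycles  x ys y B  or  y ys⁻¹ x F
-- is odd.  That odd cycle contains a D-edge (the first edge of the ear) and a
-- C-edge (the first edge of the arc), so by edge-disjointness it is neither C
-- nor D, contradicting the assumption that C and D are the only odd cycles.

open import Defs hiding (sym)
open import Defs using () renaming (sym to adj-sym)
open import Data.Nat using (ℕ; zero; suc; _+_; _*_; _≤_; s≤s; z≤n)
open import Data.Nat.Properties using (+-suc; +-identityʳ)
open import Data.Fin using (Fin; _≟_)
open import Data.Bool using (Bool; true; false; not; _xor_)
open import Data.Bool.Properties using (not-involutive; xor-same; not-distribˡ-xor; not-distribʳ-xor)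
open import Data.List using (List; []; _∷_; _++_; length; [_]; reverse; _ʳ++_)
open import Data.List.Properties using (++-assoc; ++-identityʳ; length-++; reverse-++; unfold-reverse; ʳ++-defn; reverse-involutive; length-reverse)
open import Data.List.Relation.Unary.Linked using (Linked; []; [-]; _∷_)
open import Data.List.Relation.Unary.All as All using (All; []; _∷_)
open import Data.List.Relation.Unary.All.Properties using (All¬⇒¬Any) renaming (++⁻ˡ to All-++⁻ˡ; ++⁻ʳ to All-++⁻ʳ)
open import Data.List.Relation.Unary.AllPairs using ([]; _∷_)
open import Data.List.Relation.Unary.Any using (Any; here; there)
import Data.List.Relation.Unary.First as First
open import Data.List.Relation.Unary.First.Properties using (¬All⇒First; toView)
open import Data.List.Relation.Unary.Unique.Propositional using (Unique)
import Data.List.Relation.Unary.Unique.Propositional.Properties as Unique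
open import Data.List.Relation.Binary.Disjoint.Propositional using (Disjoint)
open import Data.List.Membership.Propositional using (_∈_; _∉_; lose)
open import Data.List.Membership.Propositional.Properties using (∈-++⁺ˡ; ∈-++⁺ʳ; ∈-++⁻; ∈-∃++)
open import Data.List.Relation.Binary.Permutation.Propositional using (_↭_; ↭-sym; ↭⇒↭ₛ)
open import Data.List.Relation.Binary.Permutation.Propositional.Properties using (∈-resp-↭; ↭-reverse; ↭-length; ++-comm)
import Data.List.Relation.Binary.Permutation.Setoid.Properties as PermutationSetoid
open import Data.Product using (_×_; ∃; ∃₂; _,_; proj₁; proj₂)
open import Data.Sum using (_⊎_; inj₁; inj₂)
open import Data.Empty using (⊥; ⊥-elim)
open import Function using (_∘_)
open import Relation.Binary.PropositionalEquality using (_≡_; refl; sym; trans; cong; subst; _≢_; setoid; module ≡-Reasoning)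
open import Relation.Nullary using (¬_; yes; no; ¬?)
open import Relation.Nullary.Decidable using (decidable-stable)
open import Relation.Unary using (Decidable; ∁)

module _ {A : Set} where

  consec-++ˡ : ∀ {xs ys : List A} {u v} → Consec xs u v → Consec (xs ++ ys) u v
  consec-++ˡ here = here
  consec-++ˡ (there c) = there (consec-++ˡ c)

  consec-++ʳ : ∀ (xs : List A) {ys u v} → Consec ys u v → Consec (xs ++ ys) u v
  consec-++ʳ [] c = c
  consec-++ʳ (x ∷ xs) c = there (consec-++ʳ xs c)

  consec-prefix : ∀ (xs : List A) {y ys u v} → Consec (xs ++ [ y ]) u v → Consec (xs ++ y ∷ ys) u v
  consec-prefix xs {y} {ys} c = subst (λ l → Consec l _ _) (++-assoc xs [ y ] ys) (consec-++ˡ c)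

  consec-++⁻ : ∀ (xs : List A) {y ys u v} → Consec (xs ++ y ∷ ys) u v → Consec (xs ++ [ y ]) u v ⊎ Consec (y ∷ ys) u v
  consec-++⁻ [] c = inj₂ c
  consec-++⁻ (x ∷ []) here = inj₁ here
  consec-++⁻ (x ∷ []) (there c) = inj₂ c
  consec-++⁻ (x ∷ x′ ∷ xs) here = inj₁ here
  consec-++⁻ (x ∷ x′ ∷ xs) (there c) with consec-++⁻ (x′ ∷ xs) c
  ... | inj₁ d = inj₁ (there d)
  ... | inj₂ d = inj₂ d

  consec⇒split : ∀ {l : List A} {u v} → Consec l u v → ∃₂ λ pre post → l ≡ pre ++ u ∷ v ∷ post
  consec⇒split (here {xs = xs}) = [] , xs , refl
  consec⇒split (there {x = x} c) with consec⇒split c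
  ... | pre , post , eq = x ∷ pre , post , cong (x ∷_) eq

  split⇒consec : ∀ (pre : List A) {u v post} → Consec (pre ++ u ∷ v ∷ post) u v
  split⇒consec [] = here
  split⇒consec (x ∷ pre) = there (split⇒consec pre)

  consec-reverse : ∀ {l : List A} {u v} → Consec (reverse l) u v → Consec l v u
  consec-reverse {l} {u} {v} c with consec⇒split c
  ... | pre , post , eq = subst (λ l′ → Consec l′ v u) (sym l≡) (split⇒consec (reverse post))
    where
    open ≡-Reasoning
    l≡ : l ≡ reverse post ++ v ∷ u ∷ reverse pre
    l≡ = begin
      l                                          ≡⟨ sym (reverse-involutive l) ⟩
      reverse (reverse l)                        ≡⟨ cong reverse eq ⟩
      reverse (pre ++ u ∷ v ∷ post)              ≡⟨ reverse-++ pre (u ∷ v ∷ post) ⟩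
      (post ʳ++ (v ∷ u ∷ [])) ++ reverse pre     ≡⟨ cong (_++ reverse pre) (ʳ++-defn post) ⟩
      (reverse post ++ v ∷ u ∷ []) ++ reverse pre ≡⟨ ++-assoc (reverse post) (v ∷ u ∷ []) (reverse pre) ⟩
      reverse post ++ v ∷ u ∷ reverse pre        ∎

  first-step : ∀ (x : A) zs z → ∃ λ w → Consec (x ∷ zs ++ [ z ]) x w
  first-step x [] z = z , here
  first-step x (z′ ∷ zs) z = z′ , here

  linked⇒consec : ∀ {R : A → A → Set} {l u v} → Linked R l → Consec l u v → R u v
  linked⇒consec (r ∷ _) here = r
  linked⇒consec (_ ∷ lk) (there c) = linked⇒consec lk c
  linked⇒consec [-] (there ())

  consec⇒linked : ∀ {R : A → A → Set} (l : List A) → (∀ {u v} → Consec l u v → R u v) → Linked R l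
  consec⇒linked [] f = []
  consec⇒linked (x ∷ []) f = [-]
  consec⇒linked (x ∷ y ∷ l) f = f here ∷ consec⇒linked (y ∷ l) (f ∘ there)

  consec-loopˡ : ∀ {a b : A} ps qs {u v} → Consec (a ∷ ps ++ [ b ]) u v → Consec (a ∷ (ps ++ b ∷ qs) ++ [ a ]) u v
  consec-loopˡ {a} {b} ps qs c =
    subst (λ l → Consec (a ∷ l) _ _) (sym (++-assoc ps (b ∷ qs) [ a ])) (consec-prefix (a ∷ ps) c)

  consec-loopʳ : ∀ {a b : A} ps qs {u v} → Consec (b ∷ qs ++ [ a ]) u v → Consec (a ∷ (ps ++ b ∷ qs) ++ [ a ]) u v
  consec-loopʳ {a} {b} ps qs c =
    subst (λ l → Consec (a ∷ l) _ _) (sym (++-assoc ps (b ∷ qs) [ a ])) (consec-++ʳ (a ∷ ps) c)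

  consec-loop⁻ : ∀ {a b : A} ps qs {u v} → Consec (a ∷ (ps ++ b ∷ qs) ++ [ a ]) u v →
                 Consec (a ∷ ps ++ [ b ]) u v ⊎ Consec (b ∷ qs ++ [ a ]) u v
  consec-loop⁻ {a} {b} ps qs c =
    consec-++⁻ (a ∷ ps) (subst (λ l → Consec (a ∷ l) _ _) (++-assoc ps (b ∷ qs) [ a ]) c)

  consec-rotate : ∀ (front : List A) {h t x back u v} → h ∷ t ≡ front ++ x ∷ back →
                  Consec (x ∷ (back ++ front) ++ [ x ]) u v → Consec (h ∷ t ++ [ h ]) u v
  consec-rotate [] {x = x} {back} refl c = subst (λ l → Consec (x ∷ l ++ [ x ]) _ _) (++-identityʳ back) c
  consec-rotate (f ∷ fs) {x = x} {back} refl c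
    with consec-++⁻ (x ∷ back) (subst (λ l → Consec (x ∷ l) _ _) (++-assoc back (f ∷ fs) [ x ]) c)
  ... | inj₁ d = reassociate (consec-++ʳ (f ∷ fs) d)
    where reassociate = subst (λ l → Consec (f ∷ l) _ _) (sym (++-assoc fs (x ∷ back) [ f ]))
  ... | inj₂ d = reassociate (consec-prefix (f ∷ fs) d)
    where reassociate = subst (λ l → Consec (f ∷ l) _ _) (sym (++-assoc fs (x ∷ back) [ f ]))

  unique-++⁻ : ∀ (xs : List A) {ys} → Unique (xs ++ ys) → Unique xs × Unique ys × Disjoint xs ys
  unique-++⁻ [] u = [] , u , λ ()
  unique-++⁻ (x ∷ xs) (x∉ ∷ u) with unique-++⁻ xs u
  ... | uxs , uys , disjoint = All-++⁻ˡ xs x∉ ∷ uxs , uys , disjoint′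
    where
    disjoint′ : Disjoint (x ∷ xs) _
    disjoint′ (here refl , z∈ys) = All.lookup (All-++⁻ʳ xs x∉) z∈ys refl
    disjoint′ (there z∈xs , z∈ys) = disjoint (z∈xs , z∈ys)

  rotation-↭ : ∀ (front : List A) {l x back} → l ≡ front ++ x ∷ back → x ∷ back ++ front ↭ l
  rotation-↭ front {x = x} {back} refl = ++-comm (x ∷ back) front

  unique-resp-↭ : ∀ {xs ys : List A} → xs ↭ ys → Unique xs → Unique ys
  unique-resp-↭ p = PermutationSetoid.Unique-resp-↭ (setoid A) (↭⇒↭ₛ p)

  unique-loop : ∀ {a b : A} {ps qs} → Unique (a ∷ ps ++ [ b ]) → Unique (b ∷ qs ++ [ a ]) →
                Disjoint ps qs → Unique (a ∷ ps ++ b ∷ qs)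
  unique-loop {a} {b} {ps} {qs} (a∉ ∷ u) uqs disjoint =
    unique-resp-↭ (++-comm (ps ++ b ∷ qs) [ a ])
      (subst Unique (sym (++-assoc ps (b ∷ qs) [ a ])) (Unique.++⁺ ups uqs ps∩qs))
    where
    ups : Unique ps
    ups with unique-++⁻ ps u
    ... | ups , _ = ups
    ps∩qs : Disjoint ps (b ∷ qs ++ [ a ])
    ps∩qs (z∈ps , here refl) with unique-++⁻ ps u
    ... | _ , _ , b∉ps = b∉ps (z∈ps , here refl)
    ps∩qs (z∈ps , there z∈) with ∈-++⁻ qs z∈
    ... | inj₁ z∈qs = disjoint (z∈ps , z∈qs)
    ... | inj₂ (here refl) = All.lookup a∉ (∈-++⁺ˡ z∈ps) refl

  record Ear (P : A → Set) (l : List A) : Set where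
    field
      pre between post : List A
      x y              : A
      shape            : l ≡ pre ++ x ∷ between ++ y ∷ post
      P-x              : P x
      P-y              : P y
      avoids           : All (∁ P) between

module _ {A : Set} {P : A → Set} (P? : Decidable P) where

  firstView : ∀ {l} → Any P l → First.FirstView (∁ P) P l
  firstView any =
    toView (¬All⇒First (¬? ∘ P?) (decidable-stable (P? _)) (λ all → All¬⇒¬Any all any))

  -- A list containing two distinct elements satisfying P has an ear: take the
  -- first P-element x, and the first P-element after it.
  ear : ∀ {l u v} → u ∈ l → v ∈ l → u ≢ v → P u → P v → Ear P l
  ear {u = u} {v} u∈l v∈l u≢v Pu Pv = earFrom (firstView (lose u∈l Pu)) u∈l v∈l
    where
    earFrom : ∀ {l} → First.FirstView (∁ P) P l → u ∈ l → v ∈ l → Ear P l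
    earFrom (First._++_∷_ {pre} {x} ¬P-pre P-x rest) u∈l v∈l =
      atSecond (firstView (later (fromFirst u∈l Pu) (fromFirst v∈l Pv)))
      where
      fromFirst : ∀ {w} → w ∈ pre ++ x ∷ rest → P w → w ∈ x ∷ rest
      fromFirst w∈ Pw with ∈-++⁻ pre w∈
      ... | inj₁ w∈pre = ⊥-elim (All.lookup ¬P-pre w∈pre Pw)
      ... | inj₂ w∈rest = w∈rest
      later : u ∈ x ∷ rest → v ∈ x ∷ rest → Any P rest
      later (there u∈) _ = lose u∈ Pu
      later (here refl) (there v∈) = lose v∈ Pv
      later (here refl) (here refl) = ⊥-elim (u≢v refl)
      atSecond : First.FirstView (∁ P) P rest → Ear P (pre ++ x ∷ rest)
      atSecond (First._++_∷_ {between} {y} avoids P-y post) = record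
        { pre = pre ; between = between ; post = post ; x = x ; y = y ; shape = refl
        ; P-x = P-x ; P-y = P-y ; avoids = avoids }

parity : ℕ → Bool
parity zero = false
parity (suc k) = not (parity k)

parity-+ : ∀ m n → parity (m + n) ≡ parity m xor parity n
parity-+ zero n = refl
parity-+ (suc m) n = trans (cong not (parity-+ m n)) (not-distribˡ-xor (parity m) (parity n))

parity-double : ∀ m → parity (2 * m) ≡ false
parity-double m = begin
  parity (m + (m + 0))          ≡⟨ parity-+ m (m + 0) ⟩
  parity m xor parity (m + 0)   ≡⟨ cong (λ j → parity m xor parity j) (+-identityʳ m) ⟩
  parity m xor parity m         ≡⟨ xor-same (parity m) ⟩
  false                         ∎
  where open ≡-Reasoning

odd⇒parity : ∀ {k} → Odd k → parity k ≡ true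
odd⇒parity (m , refl) = cong not (parity-double m)

parity⇒even : ∀ k → parity k ≡ false → ∃ λ m → k ≡ 2 * m
parity⇒odd : ∀ k → parity k ≡ true → Odd k
parity⇒even zero _ = 0 , refl
parity⇒even (suc k) e with parity k in pk
parity⇒even (suc k) () | false
... | true with parity⇒odd k pk
... | m , refl = suc m , cong suc (sym (+-suc m (m + 0)))
parity⇒odd zero ()
parity⇒odd (suc k) e with parity k in pk
parity⇒odd (suc k) () | true
... | false with parity⇒even k pk
... | m , refl = m , refl

parity-loop : ∀ {A : Set} (ps : List A) b qs → parity (suc (length (ps ++ b ∷ qs))) ≡ parity (length ps) xor parity (length qs)
parity-loop ps b qs = begin
  not (parity (length (ps ++ b ∷ qs)))          ≡⟨ cong (not ∘ parity) (length-++ ps) ⟩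
  not (parity (length ps + suc (length qs)))    ≡⟨ cong not (parity-+ (length ps) (suc (length qs))) ⟩
  not (parity (length ps) xor not (parity (length qs))) ≡⟨ not-distribʳ-xor (parity (length ps)) _ ⟩
  parity (length ps) xor not (not (parity (length qs))) ≡⟨ cong (parity (length ps) xor_) (not-involutive _) ⟩
  parity (length ps) xor parity (length qs)     ∎
  where open ≡-Reasoning

xor-choice : ∀ c a b → a xor b ≡ true → c xor b ≡ true ⊎ c xor a ≡ true
xor-choice false false true _ = inj₁ refl
xor-choice false true false _ = inj₂ refl
xor-choice true false true _ = inj₂ refl
xor-choice true true false _ = inj₁ refl
xor-choice _ false false ()
xor-choice _ true true ()

odd-loop-choice : ∀ {A : Set} (ys F B : List A) {x y : A} → Odd (suc (length (F ++ y ∷ B))) →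
                  Odd (suc (length (ys ++ y ∷ B))) ⊎ Odd (suc (length (reverse ys ++ x ∷ F)))
odd-loop-choice ys F B {x} {y} oddFB
  with xor-choice (parity (length ys)) (parity (length F)) (parity (length B))
                  (trans (sym (parity-loop F y B)) (odd⇒parity oddFB))
... | inj₁ odd₁ = inj₁ (parity⇒odd _ (trans (parity-loop ys y B) odd₁))
... | inj₂ odd₂ = inj₂ (parity⇒odd _ (trans (parity-loop (reverse ys) x F)
                          (subst (λ k → parity k xor parity (length F) ≡ true) (sym (length-reverse ys)) odd₂)))

short-or-long : ∀ {A : Set} (ps : List A) b qs → (ps ≡ [] × qs ≡ []) ⊎ 2 ≤ length (ps ++ b ∷ qs)
short-or-long [] b [] = inj₁ (refl , refl)
short-or-long [] b (q ∷ qs) = inj₂ (s≤s (s≤s z≤n))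
short-or-long (p ∷ ps) b qs = inj₂ (s≤s (nonempty ps))
  where
  nonempty : ∀ ps → 1 ≤ length (ps ++ b ∷ qs)
  nonempty [] = s≤s z≤n
  nonempty (_ ∷ _) = s≤s z≤n

module _ {n : ℕ} {G : Graph n} where

  vertices : Cycle G → List (Fin n)
  vertices X = first X ∷ rest X

  EdgesIn : Cycle G → List (Fin n) → Set
  EdgesIn X ws = ∀ {p q} → Consec ws p q → EdgeOf X p q

  edge-sym : ∀ {X : Cycle G} {p q} → EdgeOf X p q → EdgeOf X q p
  edge-sym (inj₁ c) = inj₂ c
  edge-sym (inj₂ c) = inj₁ c

  edge⇒adj : ∀ {X : Cycle G} {p q} → EdgeOf X p q → Adj G p q
  edge⇒adj {X} (inj₁ c) = linked⇒consec (closed X) c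
  edge⇒adj {X} {p} {q} (inj₂ c) = trans (adj-sym G p q) (linked⇒consec (closed X) c)

  record ClosedWalk (X : Cycle G) (h : Fin n) (t : List (Fin n)) : Set where
    field
      walk-distinct : Unique (h ∷ t)
      walk-edges    : EdgesIn X (h ∷ t ++ [ h ])
  open ClosedWalk public

  cycleWalk : (X : Cycle G) → ClosedWalk X (first X) (rest X)
  cycleWalk X = record { walk-distinct = distinct X ; walk-edges = inj₁ }

  rotate : ∀ {X h t} → ClosedWalk X h t → ∀ front {x back} → h ∷ t ≡ front ++ x ∷ back →
           ClosedWalk X x (back ++ front)
  rotate W front {x} {back} eq = record
    { walk-distinct = unique-resp-↭ (++-comm front (x ∷ back)) (subst Unique eq (walk-distinct W))
    ; walk-edges    = walk-edges W ∘ consec-rotate front eq }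

  record Path (X : Cycle G) (a : Fin n) (ps : List (Fin n)) (b : Fin n) : Set where
    field
      path-distinct : Unique (a ∷ ps ++ [ b ])
      path-edges    : EdgesIn X (a ∷ ps ++ [ b ])
  open Path public

  path-ends-distinct : ∀ {X a ps b} → Path X a ps b → a ≢ b
  path-ends-distinct {ps = ps} P with path-distinct P
  ... | a∉ ∷ _ = All.lookup a∉ (∈-++⁺ʳ ps (here refl))

  subpath : ∀ {X h t} → ClosedWalk X h t → ∀ pre {x ys y post} → h ∷ t ≡ pre ++ x ∷ ys ++ y ∷ post →
            Path X x ys y
  subpath {h = h} {t} W pre {x} {ys} {y} {post} eq = record
    { path-distinct = proj₁ (unique-++⁻ (x ∷ ys ++ [ y ]) fromX)
    ; path-edges    = λ c → walk-edges W (consec-++ˡ (inWalk c)) }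
    where
    fromX : Unique ((x ∷ ys ++ [ y ]) ++ post)
    fromX = subst Unique (sym (++-assoc (x ∷ ys) [ y ] post))
                  (proj₁ (proj₂ (unique-++⁻ pre (subst Unique eq (walk-distinct W)))))
    inWalk : ∀ {u v} → Consec (x ∷ ys ++ [ y ]) u v → Consec (h ∷ t) u v
    inWalk c = subst (λ l → Consec l _ _) (sym eq) (consec-++ʳ pre (consec-prefix (x ∷ ys) c))

  reversePath : ∀ {X a ps b} → Path X a ps b → Path X b (reverse ps) a
  reversePath {X} {a} {ps} {b} P = record
    { path-distinct = subst Unique reversed (unique-resp-↭ (↭-sym (↭-reverse (a ∷ ps ++ [ b ]))) (path-distinct P))
    ; path-edges    = λ c → edge-sym {X} (path-edges P (consec-reverse (subst (λ l → Consec l _ _) (sym reversed) c))) }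
    where
    reversed : reverse (a ∷ ps ++ [ b ]) ≡ b ∷ reverse ps ++ [ a ]
    reversed = trans (unfold-reverse a (ps ++ [ b ])) (cong (_++ [ a ]) (reverse-++ ps [ b ]))

  glue : ∀ {X Y a b ps qs} → Path X a ps b → Path Y b qs a → Disjoint ps qs → 2 ≤ length (ps ++ b ∷ qs) → Cycle G
  glue {X} {Y} {a} {b} {ps} {qs} P Q disjoint 2≤ = record
    { first = a ; rest = ps ++ b ∷ qs ; long = 2≤
    ; distinct = unique-loop (path-distinct P) (path-distinct Q) disjoint
    ; closed = consec⇒linked _ adjacent }
    where
    adjacent : ∀ {u v} → Consec (a ∷ (ps ++ b ∷ qs) ++ [ a ]) u v → Adj G u v
    adjacent c with consec-loop⁻ ps qs c
    ... | inj₁ c′ = edge⇒adj {X} (path-edges P c′)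
    ... | inj₂ c′ = edge⇒adj {Y} (path-edges Q c′)

  record Arcs (X : Cycle G) (x y : Fin n) : Set where
    field
      F B      : List (Fin n)
      arc-xy   : Path X x F y
      arc-yx   : Path X y B x
      on-X     : ∀ {z} → z ∈ F ++ y ∷ B → z ∈ vertices X
      len-arcs : len X ≡ suc (length (F ++ y ∷ B))

  -- Read X from x (a rotation of its vertex list) and cut the result at y.
  arcs : (X : Cycle G) {x y : Fin n} → x ∈ vertices X → y ∈ vertices X → x ≢ y → Arcs X x y
  arcs X {x} {y} x∈X y∈X x≢y with ∈-∃++ x∈X
  ... | front , back , atX with ∈-resp-↭ (↭-sym (rotation-↭ front atX)) y∈X
  ...   | here y≡x = ⊥-elim (x≢y (sym y≡x))
  ...   | there y∈ with ∈-∃++ y∈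
  ...     | F , B , atY = record
    { F = F ; B = B
    ; arc-xy   = subpath fromX [] (cong (x ∷_) atY)
    ; arc-yx   = subpath (rotate fromX (x ∷ F) (cong (x ∷_) atY)) [] refl
    ; on-X     = λ {z} z∈ → ∈-resp-↭ (rotation-↭ front atX) (there (subst (z ∈_) (sym atY) z∈))
    ; len-arcs = trans (↭-length (↭-sym (rotation-↭ front atX))) (cong (suc ∘ length) atY) }
    where
    fromX : ClosedWalk X x (back ++ front)
    fromX = rotate (cycleWalk X) front atX

module EdgeDisjointOddCycles {n : ℕ} {G : Graph n} (C D : Cycle G)
  (only-C-D : ∀ (E : Cycle G) → Odd (len E) → SameCycle E C ⊎ SameCycle E D)
  (edge-disjoint : ∀ u v → ¬ (EdgeOf C u v × EdgeOf D u v)) where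

  -- A D-path and a C-path between the same two vertices, with disjoint
  -- interiors, never close up into an odd cycle: such a cycle contains the first
  -- edge of each path, so it is neither C nor D.  If both interiors are empty,
  -- the two paths are a single edge ab shared by C and D.
  no-odd-glue : ∀ {a b ps qs} → Path D a ps b → Path C b qs a → Disjoint ps qs →
                Odd (suc (length (ps ++ b ∷ qs))) → ⊥
  no-odd-glue {a} {b} {ps} {qs} P Q disjoint odd with short-or-long ps b qs
  ... | inj₁ (refl , refl) = edge-disjoint a b (edge-sym {X = C} (path-edges Q here) , path-edges P here)
  ... | inj₂ 2≤ = neither-C-nor-D (only-C-D (glue P Q disjoint 2≤) odd)
    where
    neither-C-nor-D : SameCycle (glue P Q disjoint 2≤) C ⊎ SameCycle (glue P Q disjoint 2≤) D → ⊥
    neither-C-nor-D (inj₁ (_ , same-edges)) with first-step a ps b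
    ... | w , c = edge-disjoint a w (proj₁ (same-edges a w) (inj₁ (consec-loopˡ ps qs c)) , path-edges P c)
    neither-C-nor-D (inj₂ (_ , same-edges)) with first-step b qs a
    ... | w , c = edge-disjoint b w (path-edges Q c , proj₁ (same-edges b w) (inj₁ (consec-loopʳ ps qs c)))

  no-ear : Odd (len C) → Ear (_∈ vertices C) (vertices D) → ⊥
  no-ear odd-C e = close (odd-loop-choice between F B (subst Odd len-arcs odd-C))
    where
    open Ear e
    ear-path : Path D x between y
    ear-path = subpath (cycleWalk D) pre shape
    open Arcs (arcs C P-x P-y (path-ends-distinct ear-path))
    off-C : ∀ {z} → z ∈ between → z ∉ F ++ y ∷ B
    off-C z∈ z∈arcs = All.lookup avoids z∈ (on-X z∈arcs)
    close : Odd (suc (length (between ++ y ∷ B))) ⊎ Odd (suc (length (reverse between ++ x ∷ F))) → ⊥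
    close (inj₁ odd) = no-odd-glue ear-path arc-yx
      (λ { (z∈ , z∈B) → off-C z∈ (∈-++⁺ʳ F (there z∈B)) }) odd
    close (inj₂ odd) = no-odd-glue (reversePath ear-path) arc-xy
      (λ { (z∈ , z∈F) → off-C (∈-resp-↭ (↭-reverse between) z∈) (∈-++⁺ˡ z∈F) }) odd

  at-most-one-common-vertex : Odd (len C) → ∀ {u v} → u ≢ v →
    VertexOf C u → VertexOf D u → VertexOf C v → VertexOf D v → ⊥
  at-most-one-common-vertex odd-C u≢v u∈C u∈D v∈C v∈D =
    no-ear odd-C (ear (_∈? vertices C) u∈D v∈D u≢v u∈C v∈C)
    where open import Data.List.Membership.DecPropositional (_≟_ {n}) using (_∈?_)

lemma2p1 : (n : ℕ) (G : Graph n) (C D : Cycle G) →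
    Odd (len C) → Odd (len D) → ¬ SameCycle C D →
    (∀ (E : Cycle G) → Odd (len E) → SameCycle E C ⊎ SameCycle E D) →
    (∀ u v → ¬ (EdgeOf C u v × EdgeOf D u v)) →
    (∀ u v → VertexOf C u → VertexOf D u → VertexOf C v → VertexOf D v → u ≡ v)
lemma2p1 n G C D odd-C _ _ only-C-D edge-disjoint u v u∈C u∈D v∈C v∈D with u ≟ v
... | yes u≡v = u≡v
... | no u≢v = ⊥-elim (EdgeDisjointOddCycles.at-most-one-common-vertex C D only-C-D edge-disjoint
                         odd-C u≢v u∈C u∈D v∈C v∈D)
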